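{- Let $S\in\mathcal{I}_1\cap\mathcal{I}_2$ be such that the shortest $s$–$t$ path in the exchange graph $G(S)$ has length $2(\ell+1)$, and let $\Pi_\ell=(B_1,A_1,B_2,A_2,\dots,B_\ell,A_\ell,B_{\ell+1})$ be an augmenting set in $G(S)$. Then $S\oplus\Pi_\ell:=S+B_1-A_1+B_2-\cdots+B_\ell-A_\ell+B_{\ell+1}$ is a common independent set, i.e. lies in $\mathcal{I}_1\cap\mathcal{I}_2$.
   Context: $\mathcal{M}_1=(V,\mathcal{I}_1)$, $\mathcal{M}_2=(V,\mathcal{I}_2)$ are matroids on a common ground set. For $S\in\mathcal{I}_1\cap\mathcal{I}_2$, the exchange graph $G(S)$ is the directed graph on $V\cup\{s,t\}$ with arcs: $(s,a)$ for $a\notin S$ with $S+a\in\mathcal{I}_1$; $(a,t)$ for $a\notin S$ with $S+a\in\mathcal{I}_2$; $(a,b)$ for $a\in S$, $b\notin S$ with $S-a+b\in\mathcal{I}_1$; $(b,a)$ for $a\in S$, $b\notin S$ with $S-a+b\in\mathcal{I}_2$. $D_i$ denotes the set of elements of $V$ at distance exactly $i$ from $s$ in $G(S)$. An augmenting set in $G(S)$ (where the shortest $s$–$t$ path has length $2(\ell+1)$) is a sequence of sets $(B_1,A_1,B_2,A_2,\dots,A_\ell,B_{\ell+1})$ such that: (a) $A_k\subseteq D_{2k}$ and $B_k\subseteq D_{2k-1}$ for all relevant $k$; (b) $|B_1|=|A_1|=|B_2|=\cdots=|B_{\ell+1}|=w$ ($w$ is the width); (c) $S+B_1\in\mathcal{I}_1$;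 (d) $S+B_{\ell+1}\in\mathcal{I}_2$; (e) $S-A_k+B_{k+1}\in\mathcal{I}_1$ for $1\le k\le\ell$; (f) $S-A_k+B_k\in\mathcal{I}_2$ for $1\le k\le\ell$. Here $X+Y$, $X-Y$ denote union and set difference. -}

module Defs where

open import Data.Nat using (ℕ; zero; suc; _+_; _*_; _<_; _≤_)
open import Data.Fin using (Fin)
open import Data.Fin.Subset using (Subset; ⊥; _∈_; _∉_; _⊆_; _∪_; _─_; _-_; ⁅_⁆; ∣_∣)
open import Data.Product using (Σ; ∃; _×_; _,_)
open import Relation.Binary.PropositionalEquality using (_≡_)
open import Data.Nat using (_∸_)
open import Relation.Nullary using (¬_)

record Matroid (n : ℕ) : Set₁ where
  field
    Indep       : Subset n → Set
    indep-∅     : Indep ⊥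
    indep-down  : ∀ {X Y} → X ⊆ Y → Indep Y → Indep X
    indep-exch  : ∀ {X Y} → Indep X → Indep Y → ∣ X ∣ < ∣ Y ∣ →
                  ∃ λ e → e ∈ Y × e ∉ X × Indep (X ∪ ⁅ e ⁆)
open Matroid public

data Node (n : ℕ) : Set where
  src : Node n
  tgt : Node n
  el  : Fin n → Node n

module _ {n : ℕ} (M₁ M₂ : Matroid n) (S : Subset n) where

  data Arc : Node n → Node n → Set where
    arc-s  : ∀ a → a ∉ S → Indep M₁ (S ∪ ⁅ a ⁆) → Arc src (el a)
    arc-t  : ∀ a → a ∉ S → Indep M₂ (S ∪ ⁅ a ⁆) → Arc (el a) tgt
    arc-12 : ∀ a b → a ∈ S → b ∉ S → Indep M₁ ((S - a) ∪ ⁅ b ⁆) → Arc (el a) (el b)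
    arc-21 : ∀ a b → a ∈ S → b ∉ S → Indep M₂ ((S - a) ∪ ⁅ b ⁆) → Arc (el b) (el a)

  data Walk : Node n → Node n → ℕ → Set where
    [] : ∀ {u} → Walk u u zero
    _∷_ : ∀ {u v w k} → Arc u v → Walk v w k → Walk u w (suc k)

  Dist : Node n → ℕ → Set
  Dist v d = Walk src v d × (∀ j → j < d → ¬ Walk src v j)

  D : ℕ → Subset n → Set
  D i X = ∀ a → a ∈ X → Dist (el a) i

  -- Augmenting set (B₁,A₁,…,A_ℓ,B_{ℓ+1}) of width w, indexed from 1
  -- (values of A, B outside the index ranges are irrelevant).
  record IsAugmentingSet (ℓ : ℕ) (A B : ℕ → Subset n) (w : ℕ) : Set where
    field
      A-layer : ∀ k → 1 ≤ k → k ≤ ℓ → D (2 * k) (A k)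
      B-layer : ∀ k → 1 ≤ k → k ≤ suc ℓ → D (2 * k ∸ 1) (B k)
      A-width : ∀ k → 1 ≤ k → k ≤ ℓ → ∣ A k ∣ ≡ w
      B-width : ∀ k → 1 ≤ k → k ≤ suc ℓ → ∣ B k ∣ ≡ w
      cond-c  : Indep M₁ (S ∪ B 1)
      cond-d  : Indep M₂ (S ∪ B (suc ℓ))
      cond-e  : ∀ k → 1 ≤ k → k ≤ ℓ → Indep M₁ ((S ─ A k) ∪ B (suc k))
      cond-f  : ∀ k → 1 ≤ k → k ≤ ℓ → Indep M₂ ((S ─ A k) ∪ B k)

-- S ⊕ Π = S + B₁ - A₁ + B₂ - ⋯ - A_ℓ + B_{ℓ+1}, evaluated left to right.
-- augPrefix S A B k = S + B₁ - A₁ + ⋯ - A_k + B_{k+1}.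
augPrefix : ∀ {n} → Subset n → (A B : ℕ → Subset n) → ℕ → Subset n
augPrefix S A B zero    = S ∪ B 1
augPrefix S A B (suc k) = (augPrefix S A B k ─ A (suc k)) ∪ B (suc (suc k))

_⊕_ : ∀ {n} → Subset n → ℕ × (ℕ → Subset n) × (ℕ → Subset n) → Subset n
S ⊕ (ℓ , A , B) = augPrefix S A B ℓ

-- On the M₁ side, S + B₁ − A₁ + ⋯ − A_k + B_{k+1} stays independent by induction on k.
-- In the step, the part of S not yet removed spans every b ∈ B_{k+2}: extending it
-- inside S + b would make S + b or S − a + b independent for some a ∈ A_i, i ≤ k, i.e.
-- give an arc s → b or a → b skipping a layer of the shortest-path layering. An exchange
-- lemma then transfers the independence of S − A_{k+1} + B_{k+2} to the whole prefix.
-- The M₂ side is the same argument run through the layers in reverse order (arcs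
-- b → t and b → a now play the role of the shortcuts), and both orders produce the same
-- set because the A_i ⊆ S are pairwise disjoint and the B_i lie outside S.
module Submission where

open import Defs
open import Data.Bool using (Bool; true; false; not)
open import Data.Bool.Properties using (not-involutive)
open import Data.Fin using (Fin)
open import Data.Fin.Subset using (Subset; inside; outside; _∈_; _∉_; _⊆_; _∪_; _∩_; _─_; _-_; ⁅_⁆; ∣_∣; ∁; Empty)
open import Data.Fin.Subset.Properties
  using (_∈?_; nonempty?; drop-∷-⊆; ⊆-refl; ⊆-trans; p⊂q⇒∣p∣<∣q∣; ∣⁅x⁆∣≡1; x∈⁅y⁆⇒x≡y;
         x∉p⇒x∈∁p; x∈∁p⇒x∉p; p⊆q⇒∁p⊇∁q; p∩q⊆p; p∩q⊆q; x∈p∩q⁺; p⊆p∪q; q⊆p∪q; x∈p∪q⁻;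
         x∈p∧x∉q⇒x∈p─q; p─q⊆p; x∈p∧x≢y⇒x∈p-y; x∈p⇒∣p-x∣<∣p∣)
open import Data.Nat using (ℕ; zero; suc; _+_; _*_; _∸_; _≤_; _<_; z≤n; s≤s; s≤s⁻¹)
open import Data.Nat.GeneralisedArithmetic using (iterate)
open import Data.Nat.Properties
  using (≤-refl; ≤-reflexive; ≤-trans; ≤-antisym; <-trans; <-≤-trans; <⇒≤; <⇒≢; <⇒≱; ≤⇒≯; ≮⇒≥; ≰⇒>;
         _≤?_; n<1+n; m<n⇒m<1+n; m≤n⇒m≤1+n; m≤n⇒m<n∨m≡n; m<1+n⇒m<n∨m≡n; m≤m+n; +-suc; +-comm;
         *-suc; *-monoʳ-<; *-cancelˡ-≡; suc-injective; m∸n≤m; ∸-monoʳ-<; ∸-cancelˡ-≡; m∸[m∸n]≡n)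
open import Data.Product using (∃; _×_; _,_; proj₁)
open import Data.Sum using (_⊎_; inj₁; inj₂; [_,_])
open import Data.Vec.Base using (_∷_; []; here; there)
open import Relation.Nullary using (¬_; yes; no; does; contradiction)
open import Relation.Nullary.Decidable using (dec-true; dec-false)
open import Relation.Binary.PropositionalEquality using (_≡_; refl; sym; trans; cong; subst; module ≡-Reasoning)

x∈p─q⇒x∉q : ∀ {n} {x : Fin n} (p q : Subset n) → x ∈ p ─ q → x ∉ q
x∈p─q⇒x∉q (_ ∷ _) (outside ∷ _) here ()
x∈p─q⇒x∉q (_ ∷ p) (_ ∷ q) (there x∈p─q) (there x∈q) = x∈p─q⇒x∉q p q x∈p─q x∈q

∣p∪q∣≡∣p∣+∣q∣ : ∀ {n} (p q : Subset n) → q ⊆ ∁ p → ∣ p ∪ q ∣ ≡ ∣ p ∣ + ∣ q ∣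
∣p∪q∣≡∣p∣+∣q∣ []            []            _    = refl
∣p∪q∣≡∣p∣+∣q∣ (inside ∷ p)  (inside ∷ q)  q⊆∁p = contradiction (q⊆∁p here) λ ()
∣p∪q∣≡∣p∣+∣q∣ (inside ∷ p)  (outside ∷ q) q⊆∁p = cong suc (∣p∪q∣≡∣p∣+∣q∣ p q (drop-∷-⊆ q⊆∁p))
∣p∪q∣≡∣p∣+∣q∣ (outside ∷ p) (inside ∷ q)  q⊆∁p =
  trans (cong suc (∣p∪q∣≡∣p∣+∣q∣ p q (drop-∷-⊆ q⊆∁p))) (sym (+-suc ∣ p ∣ ∣ q ∣))
∣p∪q∣≡∣p∣+∣q∣ (outside ∷ p) (outside ∷ q) q⊆∁p = ∣p∪q∣≡∣p∣+∣q∣ p q (drop-∷-⊆ q⊆∁p)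

∣p─q∣+∣q∣≡∣p∣ : ∀ {n} (p q : Subset n) → q ⊆ p → ∣ p ─ q ∣ + ∣ q ∣ ≡ ∣ p ∣
∣p─q∣+∣q∣≡∣p∣ []            []            _   = refl
∣p─q∣+∣q∣≡∣p∣ (outside ∷ p) (inside ∷ q)  q⊆p = contradiction (q⊆p here) λ ()
∣p─q∣+∣q∣≡∣p∣ (inside ∷ p)  (inside ∷ q)  q⊆p =
  trans (+-suc ∣ p ─ q ∣ ∣ q ∣) (cong suc (∣p─q∣+∣q∣≡∣p∣ p q (drop-∷-⊆ q⊆p)))
∣p─q∣+∣q∣≡∣p∣ (inside ∷ p)  (outside ∷ q) q⊆p = cong suc (∣p─q∣+∣q∣≡∣p∣ p q (drop-∷-⊆ q⊆p))
∣p─q∣+∣q∣≡∣p∣ (outside ∷ p) (outside ∷ q) q⊆p = ∣p─q∣+∣q∣≡∣p∣ p q (drop-∷-⊆ q⊆p)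

module _ {n : ℕ} where
  open ≡-Reasoning

  ⁅x⁆⊆p : ∀ {x} {p : Subset n} → x ∈ p → ⁅ x ⁆ ⊆ p
  ⁅x⁆⊆p {x} {p} x∈p y∈⁅x⁆ = subst (_∈ p) (sym (x∈⁅y⁆⇒x≡y x y∈⁅x⁆)) x∈p

  ∪-lub : ∀ {p q r : Subset n} → p ⊆ r → q ⊆ r → p ∪ q ⊆ r
  ∪-lub p⊆r q⊆r x∈p∪q = [ p⊆r , q⊆r ] (x∈p∪q⁻ _ _ x∈p∪q)

  ─∪-monoˡ-⊆ : ∀ {p q : Subset n} (r s : Subset n) → p ⊆ q → (p ─ r) ∪ s ⊆ (q ─ r) ∪ s
  ─∪-monoˡ-⊆ r s p⊆q = ∪-lub (λ x∈p─r → p⊆p∪q s (x∈p∧x∉q⇒x∈p─q (p⊆q (p─q⊆p _ r x∈p─r)) (x∈p─q⇒x∉q _ r x∈p─r)))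
                              (q⊆p∪q _ s)

  Empty-─⇒⊆ : ∀ {p q : Subset n} → Empty (p ─ q) → p ⊆ q
  Empty-─⇒⊆ {p} {q} p─q-empty {x} x∈p with x ∈? q
  ... | yes x∈q = x∈q
  ... | no x∉q  = contradiction (x , x∈p∧x∉q⇒x∈p─q x∈p x∉q) p─q-empty

  p⊆q∧∣q∣≤∣p∣⇒q⊆p : ∀ {p q : Subset n} → p ⊆ q → ∣ q ∣ ≤ ∣ p ∣ → q ⊆ p
  p⊆q∧∣q∣≤∣p∣⇒q⊆p {p} p⊆q ∣q∣≤∣p∣ {x} x∈q with x ∈? p
  ... | yes x∈p = x∈p
  ... | no x∉p  = contradiction (p⊂q⇒∣p∣<∣q∣ (p⊆q , x , x∈q , x∉p)) (≤⇒≯ ∣q∣≤∣p∣)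

  ∣p∪⁅x⁆∣≡1+∣p∣ : ∀ {p : Subset n} {x} → x ∉ p → ∣ p ∪ ⁅ x ⁆ ∣ ≡ suc ∣ p ∣
  ∣p∪⁅x⁆∣≡1+∣p∣ {p} {x} x∉p = begin
    ∣ p ∪ ⁅ x ⁆ ∣     ≡⟨ ∣p∪q∣≡∣p∣+∣q∣ p ⁅ x ⁆ (⁅x⁆⊆p (x∉p⇒x∈∁p x∉p)) ⟩
    ∣ p ∣ + ∣ ⁅ x ⁆ ∣ ≡⟨ cong (∣ p ∣ +_) (∣⁅x⁆∣≡1 x) ⟩
    ∣ p ∣ + 1         ≡⟨ +-comm ∣ p ∣ 1 ⟩
    suc ∣ p ∣         ∎

  ∣[p─q]∪r∣≡∣p∣ : ∀ {p q r : Subset n} → q ⊆ p → r ⊆ ∁ p → ∣ q ∣ ≡ ∣ r ∣ → ∣ (p ─ q) ∪ r ∣ ≡ ∣ p ∣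
  ∣[p─q]∪r∣≡∣p∣ {p} {q} {r} q⊆p r⊆∁p ∣q∣≡∣r∣ = begin
    ∣ (p ─ q) ∪ r ∣   ≡⟨ ∣p∪q∣≡∣p∣+∣q∣ (p ─ q) r (⊆-trans r⊆∁p (p⊆q⇒∁p⊇∁q (p─q⊆p p q))) ⟩
    ∣ p ─ q ∣ + ∣ r ∣ ≡⟨ cong (∣ p ─ q ∣ +_) (sym ∣q∣≡∣r∣) ⟩
    ∣ p ─ q ∣ + ∣ q ∣ ≡⟨ ∣p─q∣+∣q∣≡∣p∣ p q q⊆p ⟩
    ∣ p ∣             ∎

module MatroidProperties {n : ℕ} (M : Matroid n) where

  indep-augment : ∀ {X W} → Indep M X → Indep M W →
                  ∃ λ Y → X ⊆ Y × Y ⊆ X ∪ W × Indep M Y × ∣ W ∣ ≤ ∣ Y ∣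
  indep-augment {X} {W} X-indep W-indep = grow ∣ W ∣ (m≤m+n ∣ W ∣ ∣ X ∣) X-indep
    where
    grow : ∀ k {X} → ∣ W ∣ ≤ k + ∣ X ∣ → Indep M X →
           ∃ λ Y → X ⊆ Y × Y ⊆ X ∪ W × Indep M Y × ∣ W ∣ ≤ ∣ Y ∣
    grow k {X} bound X-indep with ∣ W ∣ ≤? ∣ X ∣
    ... | yes ∣W∣≤∣X∣ = X , ⊆-refl , p⊆p∪q W , X-indep , ∣W∣≤∣X∣
    grow zero bound _ | no ∣W∣≰∣X∣ = contradiction bound ∣W∣≰∣X∣
    grow (suc k) {X} bound X-indep | no ∣W∣≰∣X∣ with indep-exch M X-indep W-indep (≰⇒> ∣W∣≰∣X∣)
    ... | e , e∈W , e∉X , X+e-indep with grow k (≤-trans bound (≤-reflexive bound-step)) X+e-indep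
      where
      bound-step : suc k + ∣ X ∣ ≡ k + ∣ X ∪ ⁅ e ⁆ ∣
      bound-step = sym (trans (cong (k +_) (∣p∪⁅x⁆∣≡1+∣p∣ e∉X)) (+-suc k ∣ X ∣))
    ... | Y , X+e⊆Y , Y⊆X+e∪W , Y-indep , ∣W∣≤∣Y∣ =
      Y , ⊆-trans (p⊆p∪q _) X+e⊆Y , ⊆-trans Y⊆X+e∪W X+e∪W⊆X∪W , Y-indep , ∣W∣≤∣Y∣
      where
      X+e∪W⊆X∪W : (X ∪ ⁅ e ⁆) ∪ W ⊆ X ∪ W
      X+e∪W⊆X∪W = ∪-lub (∪-lub (p⊆p∪q W) (⊆-trans (⁅x⁆⊆p e∈W) (q⊆p∪q X W))) (q⊆p∪q X W)

  -- For independent Z, Spans Z x says that x lies in the closure of Z.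
  Spans : Subset n → Fin n → Set
  Spans Z x = Indep M (Z ∪ ⁅ x ⁆) → x ∈ Z

  spans-converse : ∀ {Y Z} → Indep M Z → Indep M Y → ∣ Z ∣ ≤ ∣ Y ∣ →
                   (∀ {y} → y ∈ Y → Spans Z y) → ∀ {z} → z ∈ Z → Spans Y z
  spans-converse {Y} {Z} Z-indep _ ∣Z∣≤∣Y∣ Y-spanned {z} z∈Z Y+z-indep with z ∈? Y
  ... | yes z∈Y = z∈Y
  ... | no z∉Y with indep-exch M Z-indep Y+z-indep (subst (∣ Z ∣ <_) (sym (∣p∪⁅x⁆∣≡1+∣p∣ z∉Y)) (s≤s ∣Z∣≤∣Y∣))
  ... | e , e∈Y+z , e∉Z , Z+e-indep with x∈p∪q⁻ Y ⁅ z ⁆ e∈Y+z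
  ... | inj₁ e∈Y    = contradiction (Y-spanned e∈Y Z+e-indep) e∉Z
  ... | inj₂ e∈⁅z⁆ = contradiction (⁅x⁆⊆p z∈Z e∈⁅z⁆) e∉Z

  -- Augment Y = (Z ─ A) ∪ B from T: Y spans Z ⊇ A, so no element of A is picked up and the
  -- result, of size at least ∣ T ∣, is (T ─ A) ∪ B.
  indep-exchange : ∀ {T Z A B} → Indep M T → Z ⊆ T → A ⊆ Z → B ⊆ ∁ T → ∣ A ∣ ≡ ∣ B ∣ →
                   Indep M ((Z ─ A) ∪ B) → (∀ {b} → b ∈ B → Spans Z b) →
                   Indep M ((T ─ A) ∪ B)
  indep-exchange {T} {Z} {A} {B} T-indep Z⊆T A⊆Z B⊆∁T ∣A∣≡∣B∣ Y-indep B-spanned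
    with indep-augment Y-indep T-indep
  ... | X , Y⊆X , X⊆Y∪T , X-indep , ∣T∣≤∣X∣ =
    indep-down M (p⊆q∧∣q∣≤∣p∣⇒q⊆p X⊆T′ ∣T′∣≤∣X∣) X-indep
    where
    Y = (Z ─ A) ∪ B

    Z-spanned : ∀ {z} → z ∈ Z → Spans Y z
    Z-spanned = spans-converse (indep-down M Z⊆T T-indep) Y-indep
      (≤-reflexive (sym (∣[p─q]∪r∣≡∣p∣ A⊆Z (⊆-trans B⊆∁T (p⊆q⇒∁p⊇∁q Z⊆T)) ∣A∣≡∣B∣)))
      (λ y∈Y → [ (λ y∈Z─A _ → p─q⊆p Z A y∈Z─A) , B-spanned ] (x∈p∪q⁻ _ B y∈Y))

    X⊆T′ : X ⊆ (T ─ A) ∪ B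
    X⊆T′ {x} x∈X with x ∈? Y | x∈p∪q⁻ Y T (X⊆Y∪T x∈X)
    ... | yes x∈Y | _        = ─∪-monoˡ-⊆ A B Z⊆T x∈Y
    ... | no x∉Y  | inj₁ x∈Y = contradiction x∈Y x∉Y
    ... | no x∉Y  | inj₂ x∈T = p⊆p∪q B (x∈p∧x∉q⇒x∈p─q x∈T x∉A)
      where
      x∉A : x ∉ A
      x∉A x∈A = x∉Y (Z-spanned (A⊆Z x∈A) (indep-down M (∪-lub Y⊆X (⁅x⁆⊆p x∈X)) X-indep))

    ∣T′∣≤∣X∣ : ∣ (T ─ A) ∪ B ∣ ≤ ∣ X ∣
    ∣T′∣≤∣X∣ = ≤-trans (≤-reflexive (∣[p─q]∪r∣≡∣p∣ (⊆-trans A⊆Z Z⊆T) B⊆∁T ∣A∣≡∣B∣)) ∣T∣≤∣X∣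

  indep-insert : ∀ {S Z x} → Indep M S → Z ⊆ S → x ∉ S → Indep M (Z ∪ ⁅ x ⁆) →
                 Indep M (S ∪ ⁅ x ⁆) ⊎ ∃ λ a → a ∈ S × a ∉ Z × Indep M ((S - a) ∪ ⁅ x ⁆)
  indep-insert {S} {Z} {x} S-indep Z⊆S x∉S Z+x-indep with indep-augment Z+x-indep S-indep
  ... | X , Z+x⊆X , X⊆Z+x∪S , X-indep , ∣S∣≤∣X∣ with nonempty? (S ─ X)
  ... | no S─X-empty =
    inj₁ (indep-down M (∪-lub (Empty-─⇒⊆ S─X-empty) (⊆-trans (q⊆p∪q Z _) Z+x⊆X)) X-indep)
  ... | yes (a , a∈S─X) =
    inj₂ (a , p─q⊆p S X a∈S─X , (λ a∈Z → a∉X (Z+x⊆X (p⊆p∪q _ a∈Z))) ,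
          indep-down M (p⊆q∧∣q∣≤∣p∣⇒q⊆p X⊆S-a+x (≤-trans ∣S-a+x∣≤∣S∣ ∣S∣≤∣X∣)) X-indep)
    where
    a∉X : a ∉ X
    a∉X = x∈p─q⇒x∉q S X a∈S─X

    X⊆S+x : X ⊆ S ∪ ⁅ x ⁆
    X⊆S+x = ⊆-trans X⊆Z+x∪S (∪-lub (∪-lub (⊆-trans Z⊆S (p⊆p∪q _)) (q⊆p∪q S _)) (p⊆p∪q _))

    X⊆S-a+x : X ⊆ (S - a) ∪ ⁅ x ⁆
    X⊆S-a+x {y} y∈X =
      [ (λ y∈S → p⊆p∪q _ (x∈p∧x≢y⇒x∈p-y y∈S λ { refl → a∉X y∈X })) , q⊆p∪q _ _ ]
        (x∈p∪q⁻ S ⁅ x ⁆ (X⊆S+x y∈X))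

    ∣S-a+x∣≤∣S∣ : ∣ (S - a) ∪ ⁅ x ⁆ ∣ ≤ ∣ S ∣
    ∣S-a+x∣≤∣S∣ = ≤-trans (≤-reflexive (∣p∪⁅x⁆∣≡1+∣p∣ {p = S - a} (λ x∈S-a → x∉S (p─q⊆p S _ x∈S-a))))
                          (x∈p⇒∣p-x∣<∣p∣ (p─q⊆p S X a∈S─X))

-- Layers are numbered from 1: A (suc i) for i < j and B (suc i) for i ≤ j are the layers
-- A₁, …, A_j and B₁, …, B_{j+1} occurring in augPrefix S A B j.
module _ {n : ℕ} {S : Subset n} {A B : ℕ → Subset n} where

  ∈augPrefix-S⁺ : ∀ {j x} → x ∈ S → (∀ {i} → i < j → x ∉ A (suc i)) → x ∈ augPrefix S A B j
  ∈augPrefix-S⁺ {zero}  x∈S _   = p⊆p∪q _ x∈S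
  ∈augPrefix-S⁺ {suc j} x∈S x∉A =
    p⊆p∪q _ (x∈p∧x∉q⇒x∈p─q (∈augPrefix-S⁺ x∈S (λ i<j → x∉A (m<n⇒m<1+n i<j))) (x∉A (n<1+n j)))

  ∉augPrefix-S⁻ : ∀ {j x} → x ∈ S → x ∉ augPrefix S A B j → ∃ λ i → i < j × x ∈ A (suc i)
  ∉augPrefix-S⁻ {zero}      x∈S x∉T = contradiction (p⊆p∪q _ x∈S) x∉T
  ∉augPrefix-S⁻ {suc j} {x} x∈S x∉T with x ∈? A (suc j)
  ... | yes x∈A = j , n<1+n j , x∈A
  ... | no x∉A with ∉augPrefix-S⁻ x∈S (λ x∈T → x∉T (p⊆p∪q _ (x∈p∧x∉q⇒x∈p─q x∈T x∉A)))
  ... | i , i<j , x∈Aᵢ = i , m<n⇒m<1+n i<j , x∈Aᵢ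

  ∈augPrefix-B⁻ : ∀ {j x} → x ∈ augPrefix S A B j → x ∉ S → ∃ λ i → i ≤ j × x ∈ B (suc i)
  ∈augPrefix-B⁻ {zero} x∈T x∉S with x∈p∪q⁻ S (B 1) x∈T
  ... | inj₁ x∈S = contradiction x∈S x∉S
  ... | inj₂ x∈B = 0 , z≤n , x∈B
  ∈augPrefix-B⁻ {suc j} x∈T x∉S with x∈p∪q⁻ _ (B (suc (suc j))) x∈T
  ... | inj₂ x∈B   = suc j , ≤-refl , x∈B
  ... | inj₁ x∈T─A with ∈augPrefix-B⁻ (p─q⊆p _ _ x∈T─A) x∉S
  ... | i , i≤j , x∈Bᵢ = i , m≤n⇒m≤1+n i≤j , x∈Bᵢ

record Separated {n : ℕ} (S : Subset n) (m : ℕ) (A B : ℕ → Subset n) : Set where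
  field
    A⊆S  : ∀ {i} → i < m → A (suc i) ⊆ S
    B⊆∁S : ∀ {i} → i ≤ m → B (suc i) ⊆ ∁ S

module _ {n m : ℕ} {S : Subset n} {A B : ℕ → Subset n} (sep : Separated S m A B) where
  open Separated sep

  ∈augPrefix-S⁻ : ∀ {j x} → j ≤ m → x ∈ augPrefix S A B j → x ∈ S → ∀ {i} → i < j → x ∉ A (suc i)
  ∈augPrefix-S⁻ {suc j} j<m x∈T x∈S i<1+j x∈A
    with x∈p∪q⁻ _ (B (suc (suc j))) x∈T | m<1+n⇒m<n∨m≡n i<1+j
  ... | inj₂ x∈B   | _        = x∈∁p⇒x∉p (B⊆∁S j<m x∈B) x∈S
  ... | inj₁ x∈T─A | inj₁ i<j = ∈augPrefix-S⁻ (<⇒≤ j<m) (p─q⊆p _ _ x∈T─A) x∈S i<j x∈A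
  ... | inj₁ x∈T─A | inj₂ refl = x∈p─q⇒x∉q _ _ x∈T─A x∈A

  ∈augPrefix-B⁺ : ∀ {j i x} → j ≤ m → i ≤ j → x ∈ B (suc i) → x ∈ augPrefix S A B j
  ∈augPrefix-B⁺ {zero} {zero} _ _ x∈B = q⊆p∪q S _ x∈B
  ∈augPrefix-B⁺ {suc j} j<m i≤1+j x∈B with m≤n⇒m<n∨m≡n i≤1+j
  ... | inj₂ refl    = q⊆p∪q _ _ x∈B
  ... | inj₁ i<1+j   =
    p⊆p∪q _ (x∈p∧x∉q⇒x∈p─q (∈augPrefix-B⁺ (<⇒≤ j<m) (s≤s⁻¹ i<1+j) x∈B)
                            (λ x∈A → x∈∁p⇒x∉p (B⊆∁S (≤-trans i≤1+j j<m) x∈B) (A⊆S j<m x∈A)))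

reverseLayers : ∀ {n} → ℕ → (ℕ → Subset n) → ℕ → Subset n
reverseLayers m L k = L (suc (m ∸ k))

module _ {n m : ℕ} {S : Subset n} {A B : ℕ → Subset n} where

  Separated-reverse : Separated S m A B → Separated S m (reverseLayers m A) (reverseLayers (suc m) B)
  Separated-reverse sep = record
    { A⊆S  = λ i<m → A⊆S (∸-monoʳ-< (s≤s z≤n) i<m)
    ; B⊆∁S = λ {i} _ → B⊆∁S (m∸n≤m m i)
    }
    where open Separated sep

  augPrefix-reverse : Separated S m A B →
                      augPrefix S A B m ⊆ augPrefix S (reverseLayers m A) (reverseLayers (suc m) B) m
  augPrefix-reverse sep {x} x∈T with x ∈? S
  ... | yes x∈S = ∈augPrefix-S⁺ x∈S (λ i<m → ∈augPrefix-S⁻ sep ≤-refl x∈T x∈S (∸-monoʳ-< (s≤s z≤n) i<m))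
  ... | no x∉S with ∈augPrefix-B⁻ x∈T x∉S
  ... | i , i≤m , x∈B = ∈augPrefix-B⁺ (Separated-reverse sep) ≤-refl (m∸n≤m m i)
                          (subst (λ k → x ∈ B (suc k)) (sym (m∸[m∸n]≡n i≤m)) x∈B)

-- What the shortest-path layering of G(S) yields for one of the two matroids: the
-- independence of S + b and S − a + b would be an arc s → b or a → b skipping a layer.
record ShortcutFreeChain {n : ℕ} (M : Matroid n) (S : Subset n) (m : ℕ) (A B : ℕ → Subset n) : Set where
  field
    separated          : Separated S m A B
    A-disjoint         : ∀ {i j x} → i < m → j < m → x ∈ A (suc i) → x ∈ A (suc j) → i ≡ j
    B-disjoint         : ∀ {i j x} → i ≤ m → j ≤ m → x ∈ B (suc i) → x ∈ B (suc j) → i ≡ j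
    balanced           : ∀ {i} → i < m → ∣ A (suc i) ∣ ≡ ∣ B (suc (suc i)) ∣
    indep-first        : Indep M (S ∪ B 1)
    indep-step         : ∀ {i} → i < m → Indep M ((S ─ A (suc i)) ∪ B (suc (suc i)))
    no-shortcut-from-S : ∀ {i b} → i < m → b ∈ B (suc (suc i)) → ¬ Indep M (S ∪ ⁅ b ⁆)
    no-shortcut        : ∀ {i j a b} → suc i < j → j ≤ m → a ∈ A (suc i) → b ∈ B (suc j) →
                         ¬ Indep M ((S - a) ∪ ⁅ b ⁆)

module _ {n m : ℕ} {M : Matroid n} {S : Subset n} {A B : ℕ → Subset n}
         (chain : ShortcutFreeChain M S m A B) where
  open ShortcutFreeChain chain
  open Separated separated
  open MatroidProperties M

  removed⊆kept : ∀ {j} → j < m → A (suc j) ⊆ augPrefix S A B j ∩ S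
  removed⊆kept {j} j<m {a} a∈A = x∈p∩q⁺ (∈augPrefix-S⁺ a∈S a∉earlier , a∈S)
    where
    a∈S : a ∈ S
    a∈S = A⊆S j<m a∈A
    a∉earlier : ∀ {i} → i < j → a ∉ A (suc i)
    a∉earlier i<j a∈Aᵢ = <⇒≢ i<j (A-disjoint (<-trans i<j j<m) j<m a∈Aᵢ a∈A)

  added⊆∁prefix : ∀ {j} → j < m → B (suc (suc j)) ⊆ ∁ (augPrefix S A B j)
  added⊆∁prefix j<m b∈B = x∉p⇒x∈∁p λ b∈T →
    let i , i≤j , b∈Bᵢ = ∈augPrefix-B⁻ b∈T (x∈∁p⇒x∉p (B⊆∁S j<m b∈B))
    in <⇒≢ (s≤s i≤j) (B-disjoint (≤-trans i≤j (<⇒≤ j<m)) j<m b∈Bᵢ b∈B)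

  kept-spans-added : ∀ {j b} → j < m → b ∈ B (suc (suc j)) → Spans (augPrefix S A B j ∩ S) b
  kept-spans-added j<m b∈B kept+b-indep
    with indep-insert (indep-down M (p⊆p∪q _) indep-first) (p∩q⊆q _ _) (x∈∁p⇒x∉p (B⊆∁S j<m b∈B)) kept+b-indep
  ... | inj₁ S+b-indep = contradiction S+b-indep (no-shortcut-from-S j<m b∈B)
  ... | inj₂ (a , a∈S , a∉kept , S-a+b-indep)
    with ∉augPrefix-S⁻ a∈S (λ a∈T → a∉kept (x∈p∩q⁺ (a∈T , a∈S)))
  ... | i , i<j , a∈Aᵢ = contradiction S-a+b-indep (no-shortcut (s≤s i<j) j<m a∈Aᵢ b∈B)

  augPrefix-indep : ∀ {j} → j ≤ m → Indep M (augPrefix S A B j)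
  augPrefix-indep {zero}  _   = indep-first
  augPrefix-indep {suc j} j<m =
    indep-exchange (augPrefix-indep (<⇒≤ j<m)) (p∩q⊆p _ _) (removed⊆kept j<m) (added⊆∁prefix j<m)
      (balanced j<m) (indep-down M (─∪-monoˡ-⊆ _ _ (p∩q⊆q _ _)) (indep-step j<m)) (kept-spans-added j<m)

module ExchangeGraph {n : ℕ} (M₁ M₂ : Matroid n) (S : Subset n) where

  _∷ʳ_ : ∀ {u v w k} → Walk M₁ M₂ S u v k → Arc M₁ M₂ S v w → Walk M₁ M₂ S u w (suc k)
  []      ∷ʳ e′ = e′ ∷ []
  (e ∷ p) ∷ʳ e′ = e ∷ (p ∷ʳ e′)

  dist-≤ : ∀ {v d k} → Dist M₁ M₂ S v d → Walk M₁ M₂ S src v k → d ≤ k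
  dist-≤ (_ , shortest) p = ≮⇒≥ (λ k<d → shortest _ k<d p)

  dist-unique : ∀ {v d e} → Dist M₁ M₂ S v d → Dist M₁ M₂ S v e → d ≡ e
  dist-unique dist-d dist-e = ≤-antisym (dist-≤ dist-d (proj₁ dist-e)) (dist-≤ dist-e (proj₁ dist-d))

  -- Every arc joins S ∪ {s} to (V ∖ S) ∪ {t}.
  side : Node n → Bool
  side src    = true
  side tgt    = false
  side (el x) = does (x ∈? S)

  arc-flips-side : ∀ {u y} → Arc M₁ M₂ S u (el y) → side (el y) ≡ not (side u)
  arc-flips-side (arc-s a a∉S _)        = dec-false (a ∈? S) a∉S
  arc-flips-side (arc-12 a b a∈S b∉S _) = trans (dec-false (b ∈? S) b∉S) (cong not (sym (dec-true (a ∈? S) a∈S)))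
  arc-flips-side (arc-21 a b a∈S b∉S _) = trans (dec-true (a ∈? S) a∈S) (cong not (sym (dec-false (b ∈? S) b∉S)))

  walk-side : ∀ {u x k} → Walk M₁ M₂ S u (el x) k → side (el x) ≡ iterate not (side u) k
  walk-side []                                = refl
  walk-side (_∷_ {v = el y} {k = k} e p)      = trans (walk-side p) (cong (λ b → iterate not b k) (arc-flips-side e))
  walk-side (_∷_ {v = src} () _)
  walk-side (_∷_ {v = tgt} _ (() ∷ _))

  iterate-not-even : ∀ i b → iterate not b (2 * i) ≡ b
  iterate-not-even zero    b = refl
  iterate-not-even (suc i) b = begin
    iterate not b (2 * suc i)         ≡⟨ cong (iterate not b) (*-suc 2 i) ⟩
    iterate not (not (not b)) (2 * i) ≡⟨ cong (λ c → iterate not c (2 * i)) (not-involutive b) ⟩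
    iterate not b (2 * i)             ≡⟨ iterate-not-even i b ⟩
    b                                 ∎
    where open ≡-Reasoning

  even-walk⇒∈S : ∀ {x} i → Walk M₁ M₂ S src (el x) (2 * i) → x ∈ S
  even-walk⇒∈S {x} i p with x ∈? S | trans (walk-side p) (iterate-not-even i true)
  ... | yes x∈S | _ = x∈S
  ... | no _    | ()

  odd-walk⇒∉S : ∀ {x} i → Walk M₁ M₂ S src (el x) (suc (2 * i)) → x ∉ S
  odd-walk⇒∉S {x} i p with x ∈? S | trans (walk-side p) (iterate-not-even i false)
  ... | no x∉S | _ = x∉S
  ... | yes _  | ()

  2+2*m<2*[1+n] : ∀ {m n} → m < n → suc (suc (2 * m)) < 2 * suc n
  2+2*m<2*[1+n] {m} {n} m<n = subst (_< 2 * suc n) (*-suc 2 m) (*-monoʳ-< 2 (s≤s m<n))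

  module AugmentingLayers {ℓ A B w} (tgt-dist : Dist M₁ M₂ S tgt (2 * suc ℓ))
                          (aug : IsAugmentingSet M₁ M₂ S ℓ A B w) where
    open IsAugmentingSet aug

    A-dist : ∀ {i x} → i < ℓ → x ∈ A (suc i) → Dist M₁ M₂ S (el x) (2 * suc i)
    A-dist i<ℓ x∈A = A-layer _ (s≤s z≤n) i<ℓ _ x∈A

    B-dist : ∀ {i x} → i ≤ ℓ → x ∈ B (suc i) → Dist M₁ M₂ S (el x) (suc (2 * i))
    B-dist {i} {x} i≤ℓ x∈B =
      subst (Dist M₁ M₂ S (el x)) (cong (_∸ 1) (*-suc 2 i)) (B-layer _ (s≤s z≤n) (s≤s i≤ℓ) _ x∈B)

    A⊆S : ∀ {i} → i < ℓ → A (suc i) ⊆ S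
    A⊆S {i} i<ℓ x∈A = even-walk⇒∈S (suc i) (proj₁ (A-dist i<ℓ x∈A))

    ∈B⇒∉S : ∀ {i x} → i ≤ ℓ → x ∈ B (suc i) → x ∉ S
    ∈B⇒∉S {i} i≤ℓ x∈B = odd-walk⇒∉S i (proj₁ (B-dist i≤ℓ x∈B))

    separated : Separated S ℓ A B
    separated = record
      { A⊆S  = A⊆S
      ; B⊆∁S = λ i≤ℓ x∈B → x∉p⇒x∈∁p (∈B⇒∉S i≤ℓ x∈B)
      }

    A-disjoint : ∀ {i j x} → i < ℓ → j < ℓ → x ∈ A (suc i) → x ∈ A (suc j) → i ≡ j
    A-disjoint i<ℓ j<ℓ x∈Aᵢ x∈Aⱼ =
      suc-injective (*-cancelˡ-≡ _ _ 2 (dist-unique (A-dist i<ℓ x∈Aᵢ) (A-dist j<ℓ x∈Aⱼ)))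

    B-disjoint : ∀ {i j x} → i ≤ ℓ → j ≤ ℓ → x ∈ B (suc i) → x ∈ B (suc j) → i ≡ j
    B-disjoint i≤ℓ j≤ℓ x∈Bᵢ x∈Bⱼ =
      *-cancelˡ-≡ _ _ 2 (suc-injective (dist-unique (B-dist i≤ℓ x∈Bᵢ) (B-dist j≤ℓ x∈Bⱼ)))

    same-width : ∀ {i j} → i < ℓ → j ≤ ℓ → ∣ A (suc i) ∣ ≡ ∣ B (suc j) ∣
    same-width i<ℓ j≤ℓ = trans (A-width _ (s≤s z≤n) i<ℓ) (sym (B-width _ (s≤s z≤n) (s≤s j≤ℓ)))

    M₁-no-shortcut-from-S : ∀ {i b} → i < ℓ → b ∈ B (suc (suc i)) → ¬ Indep M₁ (S ∪ ⁅ b ⁆)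
    M₁-no-shortcut-from-S i<ℓ b∈B S+b-indep =
      <⇒≱ (s≤s (s≤s z≤n)) (dist-≤ (B-dist i<ℓ b∈B) (arc-s _ (∈B⇒∉S i<ℓ b∈B) S+b-indep ∷ []))

    M₁-no-shortcut : ∀ {i j a b} → suc i < j → j ≤ ℓ → a ∈ A (suc i) → b ∈ B (suc j) →
                     ¬ Indep M₁ ((S - a) ∪ ⁅ b ⁆)
    M₁-no-shortcut {a = a} {b} i+1<j j≤ℓ a∈A b∈B S-a+b-indep =
      <⇒≱ (s≤s (*-monoʳ-< 2 i+1<j))
          (dist-≤ (B-dist j≤ℓ b∈B) (proj₁ (A-dist i<ℓ a∈A) ∷ʳ arc-12 a b (A⊆S i<ℓ a∈A) (∈B⇒∉S j≤ℓ b∈B) S-a+b-indep))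
      where
      i<ℓ = <⇒≤ (<-≤-trans i+1<j j≤ℓ)

    M₂-no-shortcut-to-tgt : ∀ {i b} → i < ℓ → b ∈ B (suc i) → ¬ Indep M₂ (S ∪ ⁅ b ⁆)
    M₂-no-shortcut-to-tgt i<ℓ b∈B S+b-indep =
      <⇒≱ (2+2*m<2*[1+n] i<ℓ)
          (dist-≤ tgt-dist (proj₁ (B-dist (<⇒≤ i<ℓ) b∈B) ∷ʳ arc-t _ (∈B⇒∉S (<⇒≤ i<ℓ) b∈B) S+b-indep))

    M₂-no-shortcut : ∀ {i j a b} → j < i → i < ℓ → a ∈ A (suc i) → b ∈ B (suc j) →
                     ¬ Indep M₂ ((S - a) ∪ ⁅ b ⁆)
    M₂-no-shortcut {a = a} {b} j<i i<ℓ a∈A b∈B S-a+b-indep =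
      <⇒≱ (2+2*m<2*[1+n] j<i)
          (dist-≤ (A-dist i<ℓ a∈A) (proj₁ (B-dist j≤ℓ b∈B) ∷ʳ arc-21 a b (A⊆S i<ℓ a∈A) (∈B⇒∉S j≤ℓ b∈B) S-a+b-indep))
      where
      j≤ℓ = <⇒≤ (<-trans j<i i<ℓ)

    M₁-chain : ShortcutFreeChain M₁ S ℓ A B
    M₁-chain = record
      { separated          = separated
      ; A-disjoint         = A-disjoint
      ; B-disjoint         = B-disjoint
      ; balanced           = λ i<ℓ → same-width i<ℓ i<ℓ
      ; indep-first        = cond-c
      ; indep-step         = λ i<ℓ → cond-e _ (s≤s z≤n) i<ℓ
      ; no-shortcut-from-S = M₁-no-shortcut-from-S
      ; no-shortcut        = M₁-no-shortcut
      }

    M₂-chain : ShortcutFreeChain M₂ S ℓ (reverseLayers ℓ A) (reverseLayers (suc ℓ) B)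
    M₂-chain = record
      { separated          = Separated-reverse separated
      ; A-disjoint         = λ i<ℓ j<ℓ x∈Aᵢ x∈Aⱼ →
                               suc-injective (∸-cancelˡ-≡ i<ℓ j<ℓ (A-disjoint (rev< i<ℓ) (rev< j<ℓ) x∈Aᵢ x∈Aⱼ))
      ; B-disjoint         = λ {i} {j} i≤ℓ j≤ℓ x∈Bᵢ x∈Bⱼ →
                               ∸-cancelˡ-≡ i≤ℓ j≤ℓ (B-disjoint (m∸n≤m ℓ i) (m∸n≤m ℓ j) x∈Bᵢ x∈Bⱼ)
      ; balanced           = λ i<ℓ → same-width (rev< i<ℓ) (<⇒≤ (rev< i<ℓ))
      ; indep-first        = cond-d
      ; indep-step         = λ i<ℓ → cond-f _ (s≤s z≤n) (rev< i<ℓ)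
      ; no-shortcut-from-S = λ i<ℓ → M₂-no-shortcut-to-tgt (rev< i<ℓ)
      ; no-shortcut        = λ i+1<j j≤ℓ →
                               M₂-no-shortcut (∸-monoʳ-< i+1<j j≤ℓ) (rev< (<⇒≤ (<-≤-trans i+1<j j≤ℓ)))
      }
      where
      rev< : ∀ {i} → i < ℓ → ℓ ∸ suc i < ℓ
      rev< = ∸-monoʳ-< (s≤s z≤n)

theorem6p5 : ∀ {n : ℕ} (M₁ M₂ : Matroid n) (S : Subset n) →
    Indep M₁ S → Indep M₂ S →
    (ℓ : ℕ) → Dist M₁ M₂ S tgt (2 * suc ℓ) →
    (A B : ℕ → Subset n) (w : ℕ) → IsAugmentingSet M₁ M₂ S ℓ A B w →
    Indep M₁ (S ⊕ (ℓ , A , B)) × Indep M₂ (S ⊕ (ℓ , A , B))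
theorem6p5 M₁ M₂ S _ _ ℓ tgt-dist A B w aug =
    augPrefix-indep M₁-chain ≤-refl
  , indep-down M₂ (augPrefix-reverse separated) (augPrefix-indep M₂-chain ≤-refl)
  where open ExchangeGraph.AugmentingLayers M₁ M₂ S tgt-dist aug
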